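{- Let $v\ge 4$, $d\ge 1$. For every $D\in\mathcal{D}_{v,d}$, the permutation $\pi_D^{rc}$ equals $\pi_{D'}$ for some $D'\in\mathcal{D}_{v,d}$. Moreover, for every pattern $p$, \[\{\pi_D^{rc} : D\in\mathcal{D}_{v,d}(p)\} = \{\pi_D : D\in\mathcal{D}_{v,d}(p^{rc})\},\] and more generally, for every $k\ge 1$ and patterns $p_1,\dots,p_k$, \[\{\pi_D^{rc} : D\in\mathcal{D}_{v,d}(p_1,\dots,p_k)\} = \{\pi_D : D\in\mathcal{D}_{v,d}(p_1^{rc},\dots,p_k^{rc})\}.\]
   Context: A diamond with $v$ vertices ($v\ge4$) is the poset with a least element, a greatest element, and $v-2$ pairwise incomparable middle elements (in a fixed left-to-right order) strictly between them. $\mathcal{D}_{v,d}$ is the set of labellings of $d$ diamonds (placed left to right) by $1,\dots,vd$, each label used once, such that in each diamond least label $<$ each middle label $<$ greatest label. For $D\in\mathcal{D}_{v,d}$, $\pi_D$ is the permutation of $\{1,\dots,vd\}$ obtained by reading the diamonds from left to right and, within each diamond, the least element, then the middle elements from left to right, then the greatest element. Classical pattern containment/avoidance is used; $\mathcal{D}_{v,d}(P)$ is the set of $D$ with $\pi_D$ avoiding every pattern in $P$. For a permutation $\pi=\pi_1\cdots\pi_n$, the reverse-complement is $\pi^{rc}=\pi^{rc}_1\cdots\pi^{rc}_n$ with $\pi^{rc}_i = n+1-\pi_{n+1-i}$. -}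

module Defs where

open import Data.Nat using (ℕ; zero; suc; _+_; _*_; _∸_; _<_)
open import Data.Fin using (Fin; toℕ; cast)
open import Data.List using (List; []; _∷_; _++_; [_]; map; concat; length; lookup; reverse; upTo; allFin)
open import Data.List.Relation.Binary.Sublist.Propositional using (_⊆_)
open import Data.List.Relation.Binary.Permutation.Propositional using (_↭_)
open import Data.List.Relation.Unary.All using (All)
open import Data.Product using (Σ; _×_; ∃)
open import Relation.Binary.PropositionalEquality using (_≡_)
open import Relation.Nullary using (¬_)
open import Function.Bundles using (_⇔_)

IsPerm : List ℕ → Set
IsPerm π = π ↭ map suc (upTo (length π))

IsPattern : List ℕ → Set
IsPattern = IsPerm

OrderIso : List ℕ → List ℕ → Set
OrderIso σ p = Σ (length σ ≡ length p) λ eq →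
  ∀ (i j : Fin (length σ)) →
    (lookup σ i < lookup σ j) ⇔ (lookup p (cast eq i) < lookup p (cast eq j))

Contains : List ℕ → List ℕ → Set
Contains π p = ∃ λ σ → (σ ⊆ π) × OrderIso σ p

Avoids : List ℕ → List ℕ → Set
Avoids π p = ¬ Contains π p

rc : List ℕ → List ℕ
rc π = map (λ x → suc (length π) ∸ x) (reverse π)

-- A labelling of d diamonds with v vertices each: for diamond i, the label of
-- the least element, of the (v - 2) middle elements (left to right), and of
-- the greatest element.
record Labelling (v d : ℕ) : Set where
  field
    least : Fin d → ℕ
    mid   : Fin d → Fin (v ∸ 2) → ℕ
    top   : Fin d → ℕ
open Labelling public

πD : ∀ {v d} → Labelling v d → List ℕ
πD {v} {d} D =
  concat (map (λ i → least D i ∷ (map (mid D i) (allFin (v ∸ 2)) ++ [ top D i ])) (allFin d))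

IsDiamondLabelling : ∀ {v d} → Labelling v d → Set
IsDiamondLabelling {v} {d} D =
  (πD D ↭ map suc (upTo (v * d))) ×
  (∀ (i : Fin d) (j : Fin (v ∸ 2)) → (least D i < mid D i j) × (mid D i j < top D i))

InDP : ∀ {v d} → List (List ℕ) → Labelling v d → Set
InDP P D = IsDiamondLabelling D × All (Avoids (πD D)) P

-- Reverse-complementing πD turns the row of diamonds upside down and back to
-- front: diamond i becomes diamond d − 1 − i with least and greatest elements
-- exchanged, middles in reverse order, and every label x replaced by vd + 1 − x.
-- This is again a diamond labelling.  Order isomorphism only depends on the set
-- of pairs (σᵢ, pᵢ), which reversal preserves and complementation of both
-- coordinates maps to a concordant set, so occurrences of p in π correspond to
-- occurrences of rc p in rc π; as rc is an involution on permutations, it maps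
-- 𝒟_{v,d}(P) onto the πD-images of 𝒟_{v,d}(rc P).
module Submission where

open import Defs
open import Data.Nat using (ℕ; suc; _∸_; _<_; _≤_; _≥_)
open import Data.Nat.Properties using (∸-monoʳ-<; ∸-cancelʳ-<; m∸n≤m; m∸[m∸n]≡n; m≤n⇒m≤1+n; suc-injective)
open import Data.Fin using (Fin; zero; suc; cast; opposite; inject₁; fromℕ)
open import Data.List using (List; []; _∷_; _++_; [_]; _∷ʳ_; map; concat; length; lookup; reverse; reverseAcc; upTo; allFin; tabulate; zip; applyUpTo; applyDownFrom)
open import Data.List.Properties using (length-map; length-reverse; length-upTo; reverse-map; reverse-++; reverse-involutive; unfold-reverse; reverse-applyDownFrom; map-applyUpTo; map-tabulate; map-∘; map-cong; map-++; concat-map; concat-++; ++-identityʳ; zip-map)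
open import Data.List.Relation.Unary.All as All using (All; []; _∷_)
import Data.List.Relation.Unary.All.Properties as All
open import Data.List.Relation.Unary.Any using (here; there)
open import Data.List.Relation.Unary.Any.Properties using (reverse⁻)
open import Data.List.Membership.Propositional using (_∈_)
open import Data.List.Membership.Propositional.Properties using (∈-map⁺; ∈-map⁻; ∈-allFin; ∈-concat⁺′; ∈-++⁺ˡ; ∈-++⁺ʳ)
open import Data.List.Relation.Binary.Permutation.Propositional using (_↭_; ↭-sym; ↭-trans)
open import Data.List.Relation.Binary.Permutation.Propositional.Properties using (All-resp-↭; ↭-length; ↭-reverse)
import Data.List.Relation.Binary.Permutation.Propositional.Properties as Perm
open import Data.List.Relation.Binary.Sublist.Propositional.Properties using (All-resp-⊆)
import Data.List.Relation.Binary.Sublist.Propositional.Properties as Sublist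
import Data.List.Relation.Binary.Sublist.Heterogeneous.Properties as Sublistʰ
open import Data.Product using (Σ; _×_; ∃; _,_; proj₁)
import Data.Product as Product
open import Relation.Binary.PropositionalEquality using (_≡_; refl; sym; trans; cong; cong₂; subst; subst₂; module ≡-Reasoning)
open import Function.Base using (_∘_)
open import Function.Bundles using (_⇔_; mk⇔)
import Function.Properties.Equivalence as ⇔

private
  variable
    A B : Set

lookup-∈-zip : ∀ (xs : List A) (ys : List B) (eq : length xs ≡ length ys) i →
  (lookup xs i , lookup ys (cast eq i)) ∈ zip xs ys
lookup-∈-zip (x ∷ xs) (y ∷ ys) eq zero    = here refl
lookup-∈-zip (x ∷ xs) (y ∷ ys) eq (suc i) = there (lookup-∈-zip xs ys (suc-injective eq) i)

∈-zip⇒lookup : ∀ (xs : List A) (ys : List B) (eq : length xs ≡ length ys) {a} →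
  a ∈ zip xs ys → ∃ λ i → a ≡ (lookup xs i , lookup ys (cast eq i))
∈-zip⇒lookup (x ∷ xs) (y ∷ ys) eq (here refl) = zero , refl
∈-zip⇒lookup (x ∷ xs) (y ∷ ys) eq (there a∈) =
  let i , a≡ = ∈-zip⇒lookup xs ys (suc-injective eq) a∈ in suc i , a≡

∈-zip⁻ : ∀ (xs : List A) (ys : List B) {x y} → (x , y) ∈ zip xs ys → x ∈ xs × y ∈ ys
∈-zip⁻ (x ∷ xs) (y ∷ ys) (here refl) = here refl , here refl
∈-zip⁻ (x ∷ xs) (y ∷ ys) (there xy∈) = Product.map there there (∈-zip⁻ xs ys xy∈)

zip-reverseAcc : ∀ (as xs : List A) (bs ys : List B) → length xs ≡ length ys →
  zip (reverseAcc as xs) (reverseAcc bs ys) ≡ reverseAcc (zip as bs) (zip xs ys)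
zip-reverseAcc as []       bs []       _  = refl
zip-reverseAcc as (x ∷ xs) bs (y ∷ ys) eq = zip-reverseAcc (x ∷ as) xs (y ∷ bs) ys (suc-injective eq)

zip-reverse : ∀ (xs : List A) (ys : List B) → length xs ≡ length ys →
  zip (reverse xs) (reverse ys) ≡ reverse (zip xs ys)
zip-reverse xs ys = zip-reverseAcc [] xs [] ys

tabulate-∷ʳ : ∀ {n} (g : Fin (suc n) → A) → tabulate g ≡ tabulate (g ∘ inject₁) ∷ʳ g (fromℕ n)
tabulate-∷ʳ {n = 0}     g = refl
tabulate-∷ʳ {n = suc n} g = cong (g zero ∷_) (tabulate-∷ʳ (g ∘ suc))

reverse-tabulate : ∀ {n} (g : Fin n → A) → reverse (tabulate g) ≡ tabulate (g ∘ opposite)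
reverse-tabulate {n = 0}     g = refl
reverse-tabulate {n = suc n} g = begin
  reverse (tabulate g)                            ≡⟨ cong reverse (tabulate-∷ʳ g) ⟩
  reverse (tabulate (g ∘ inject₁) ∷ʳ g (fromℕ n)) ≡⟨ reverse-++ (tabulate (g ∘ inject₁)) [ g (fromℕ n) ] ⟩
  g (fromℕ n) ∷ reverse (tabulate (g ∘ inject₁))  ≡⟨ cong (g (fromℕ n) ∷_) (reverse-tabulate (g ∘ inject₁)) ⟩
  tabulate (g ∘ opposite)                         ∎
  where open ≡-Reasoning

reverse-map-allFin : ∀ {n} (g : Fin n → A) → reverse (map g (allFin n)) ≡ map (g ∘ opposite) (allFin n)
reverse-map-allFin g = begin
  reverse (map g (tabulate (λ i → i))) ≡⟨ cong reverse (map-tabulate (λ i → i) g) ⟩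
  reverse (tabulate g)                 ≡⟨ reverse-tabulate g ⟩
  tabulate (g ∘ opposite)              ≡⟨ sym (map-tabulate (λ i → i) (g ∘ opposite)) ⟩
  map (g ∘ opposite) (allFin _)        ∎
  where open ≡-Reasoning

reverse-concat : ∀ (xss : List (List A)) → reverse (concat xss) ≡ concat (reverse (map reverse xss))
reverse-concat []         = refl
reverse-concat (xs ∷ xss) = begin
  reverse (xs ++ concat xss)                           ≡⟨ reverse-++ xs (concat xss) ⟩
  reverse (concat xss) ++ reverse xs                   ≡⟨ cong (_++ reverse xs) (reverse-concat xss) ⟩
  concat yss ++ reverse xs                             ≡⟨ cong (concat yss ++_) (sym (++-identityʳ (reverse xs))) ⟩
  concat yss ++ concat [ reverse xs ]                  ≡⟨ concat-++ yss [ reverse xs ] ⟩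
  concat (yss ∷ʳ reverse xs)                           ≡⟨ cong concat (sym (unfold-reverse (reverse xs) (map reverse xss))) ⟩
  concat (reverse (map reverse (xs ∷ xss)))            ∎
  where
  open ≡-Reasoning
  yss = reverse (map reverse xss)

reverse-∷-∷ʳ : ∀ (x : A) ys z → reverse (x ∷ (ys ∷ʳ z)) ≡ z ∷ (reverse ys ∷ʳ x)
reverse-∷-∷ʳ x ys z = trans (unfold-reverse x (ys ∷ʳ z)) (cong (_∷ʳ x) (reverse-++ ys [ z ]))

applyUpTo-∸ : ∀ n → applyUpTo (n ∸_) n ≡ applyDownFrom suc n
applyUpTo-∸ 0       = refl
applyUpTo-∸ (suc n) = cong (suc n ∷_) (applyUpTo-∸ n)

complement : ℕ → ℕ → ℕ
complement n x = suc n ∸ x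

reverseComplement : ℕ → List ℕ → List ℕ
reverseComplement n xs = map (complement n) (reverse xs)

length-reverseComplement : ∀ n xs → length (reverseComplement n xs) ≡ length xs
length-reverseComplement n xs = trans (length-map (complement n) (reverse xs)) (length-reverse xs)

complement-antitone : ∀ {n x y} → x < y → y ≤ suc n → complement n y < complement n x
complement-antitone x<y y≤ = ∸-monoʳ-< x<y y≤

complement-<-⇔ : ∀ {n x y} → y ≤ suc n → (x < y) ⇔ (complement n y < complement n x)
complement-<-⇔ y≤ = mk⇔ (λ x<y → complement-antitone x<y y≤) ∸-cancelʳ-<

Concordant : ℕ × ℕ → ℕ × ℕ → Set
Concordant (x , y) (x′ , y′) = (x < x′) ⇔ (y < y′)

-- Quantifying over members rather than positions makes the notion blind to
-- the order of the pairs, hence invariant under reversal.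
AllConcordant : List (ℕ × ℕ) → Set
AllConcordant ps = ∀ {a b} → a ∈ ps → b ∈ ps → Concordant a b

orderIso⇒allConcordant : ∀ {σ p} → OrderIso σ p → AllConcordant (zip σ p)
orderIso⇒allConcordant {σ} {p} (eq , iso) a∈ b∈
  with ∈-zip⇒lookup σ p eq a∈ | ∈-zip⇒lookup σ p eq b∈
... | i , refl | j , refl = iso i j

allConcordant⇒orderIso : ∀ {σ p} → length σ ≡ length p → AllConcordant (zip σ p) → OrderIso σ p
allConcordant⇒orderIso {σ} {p} eq conc =
  eq , λ i j → conc (lookup-∈-zip σ p eq i) (lookup-∈-zip σ p eq j)

concordant-complement : ∀ {n k x x′ y y′} → x ≤ suc n → y ≤ suc k →
  Concordant (x′ , y′) (x , y) → Concordant (complement n x , complement k y) (complement n x′ , complement k y′)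
concordant-complement x≤ y≤ conc = ⇔.trans (⇔.sym (complement-<-⇔ x≤)) (⇔.trans conc (complement-<-⇔ y≤))

allConcordant-complement : ∀ {n k} ps → (∀ {x y} → (x , y) ∈ ps → x ≤ suc n × y ≤ suc k) →
  AllConcordant ps → AllConcordant (map (Product.map (complement n) (complement k)) (reverse ps))
allConcordant-complement ps bound conc a∈ b∈
  with ∈-map⁻ _ a∈ | ∈-map⁻ _ b∈
... | _ , a∈rev , refl | _ , b∈rev , refl =
  let x≤ , y≤ = bound (reverse⁻ a∈rev)
  in concordant-complement x≤ y≤ (conc (reverse⁻ b∈rev) (reverse⁻ a∈rev))

orderIso-reverseComplement : ∀ {n k σ p} → All (_≤ suc n) σ → All (_≤ suc k) p →
  OrderIso σ p → OrderIso (reverseComplement n σ) (reverseComplement k p)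
orderIso-reverseComplement {n} {k} {σ} {p} σ≤ p≤ iso@(eq , _) =
  allConcordant⇒orderIso lengths (subst AllConcordant (sym pairs) complemented)
  where
  lengths : length (reverseComplement n σ) ≡ length (reverseComplement k p)
  lengths = trans (length-reverseComplement n σ) (trans eq (sym (length-reverseComplement k p)))
  pairs : zip (reverseComplement n σ) (reverseComplement k p)
        ≡ map (Product.map (complement n) (complement k)) (reverse (zip σ p))
  pairs = trans (zip-map (complement n) (complement k) (reverse σ) (reverse p))
                (cong (map _) (zip-reverse σ p eq))
  complemented : AllConcordant (map (Product.map (complement n) (complement k)) (reverse (zip σ p)))
  complemented = allConcordant-complement (zip σ p)
    (λ xy∈ → let x∈ , y∈ = ∈-zip⁻ σ p xy∈ in All.lookup σ≤ x∈ , All.lookup p≤ y∈)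
    (orderIso⇒allConcordant iso)

-- Values up to n + 1, where n is the length: the range on which complement
-- (length π) is an involution despite the truncated subtraction.
Bounded : List ℕ → Set
Bounded π = All (_≤ suc (length π)) π

oneTo : ℕ → List ℕ
oneTo n = map suc (upTo n)

length-oneTo : ∀ n → length (oneTo n) ≡ n
length-oneTo n = trans (length-map suc (upTo n)) (length-upTo n)

perm⇒bounded : ∀ {π n} → π ↭ oneTo n → Bounded π
perm⇒bounded {π} {n} π↭ =
  subst (λ m → All (_≤ suc m) π) (sym (trans (↭-length π↭) (length-oneTo n)))
    (All.map m≤n⇒m≤1+n (All-resp-↭ (↭-sym π↭) (All.map⁺ (All.all-upTo n))))

rc-bounded : ∀ π → Bounded (rc π)
rc-bounded π = subst (λ m → All (_≤ suc m) (rc π)) (sym (length-reverseComplement (length π) π))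
  (All.map⁺ (All.universal (λ x → m∸n≤m (suc (length π)) x) (reverse π)))

map-complement-involutive : ∀ {n xs} → All (_≤ suc n) xs → map (complement n) (map (complement n) xs) ≡ xs
map-complement-involutive []           = refl
map-complement-involutive (x≤ ∷ xs≤) = cong₂ _∷_ (m∸[m∸n]≡n x≤) (map-complement-involutive xs≤)

rc-involutive : ∀ {π} → Bounded π → rc (rc π) ≡ π
rc-involutive {π} π≤ = begin
  rc (rc π)                           ≡⟨ cong (λ m → reverseComplement m (rc π)) (length-reverseComplement n π) ⟩
  map c (reverse (map c (reverse π))) ≡⟨ cong (map c) (sym (reverse-map c (reverse π))) ⟩
  map c (map c (reverse (reverse π))) ≡⟨ cong (map c ∘ map c) (reverse-involutive π) ⟩
  map c (map c π)                     ≡⟨ map-complement-involutive π≤ ⟩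
  π                                   ∎
  where
  open ≡-Reasoning
  n = length π
  c = complement n

reverseComplement-oneTo : ∀ n → reverseComplement n (oneTo n) ≡ oneTo n
reverseComplement-oneTo n = begin
  map c (reverse (oneTo n))        ≡⟨ reverse-map c (oneTo n) ⟩
  reverse (map c (oneTo n))        ≡⟨ cong reverse (sym (map-∘ (upTo n))) ⟩
  reverse (map (c ∘ suc) (upTo n)) ≡⟨ cong reverse (map-applyUpTo (λ i → i) (c ∘ suc) n) ⟩
  reverse (applyUpTo (n ∸_) n)     ≡⟨ cong reverse (applyUpTo-∸ n) ⟩
  reverse (applyDownFrom suc n)    ≡⟨ reverse-applyDownFrom suc n ⟩
  applyUpTo suc n                  ≡⟨ sym (map-applyUpTo (λ i → i) suc n) ⟩
  oneTo n                          ∎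
  where
  open ≡-Reasoning
  c = complement n

rc-perm : ∀ {π n} → π ↭ oneTo n → rc π ↭ oneTo n
rc-perm {π} {n} π↭ =
  subst₂ _↭_ (cong (λ m → reverseComplement m π) (sym (trans (↭-length π↭) (length-oneTo n))))
             (reverseComplement-oneTo n)
    (Perm.map⁺ (complement n) (↭-trans (↭-reverse π) (↭-trans π↭ (↭-sym (↭-reverse (oneTo n))))))

contains-rc : ∀ {π p} → Bounded π → Bounded p → Contains π p → Contains (rc π) (rc p)
contains-rc {π} π≤ p≤ (σ , σ⊆π , iso) =
  reverseComplement (length π) σ ,
  Sublist.map⁺ (complement (length π)) (Sublistʰ.reverse⁺ σ⊆π) ,
  orderIso-reverseComplement (All-resp-⊆ σ⊆π π≤) p≤ iso

rc-contains : ∀ {π p} → Bounded π → Bounded p → Contains (rc π) p → Contains π (rc p)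
rc-contains {π} {p} π≤ p≤ rcπ⊇p =
  subst (λ τ → Contains τ (rc p)) (rc-involutive π≤) (contains-rc (rc-bounded π) p≤ rcπ⊇p)

avoids-rc : ∀ {π p} → Bounded π → IsPattern p → Avoids π (rc p) → Avoids (rc π) p
avoids-rc π≤ p-pat π⊉rcp rcπ⊇p = π⊉rcp (rc-contains π≤ (perm⇒bounded p-pat) rcπ⊇p)

avoids-rc-rc : ∀ {π p} → Bounded π → IsPattern p → Avoids π p → Avoids (rc π) (rc p)
avoids-rc-rc {π} {p} π≤ p-pat π⊉p rcπ⊇rcp =
  π⊉p (subst (Contains π) (rc-involutive (perm⇒bounded p-pat)) (rc-contains π≤ (rc-bounded p) rcπ⊇rcp))

all-avoids-rc : ∀ {π P} → Bounded π → All IsPattern P → All (Avoids π) (map rc P) → All (Avoids (rc π)) P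
all-avoids-rc π≤ patterns avoid =
  All.zipWith (λ (p-pat , av) → avoids-rc π≤ p-pat av) (patterns , All.map⁻ avoid)

all-avoids-rc-rc : ∀ {π P} → Bounded π → All IsPattern P → All (Avoids π) P → All (Avoids (rc π)) (map rc P)
all-avoids-rc-rc π≤ patterns avoid =
  All.map⁺ (All.zipWith (λ (p-pat , av) → avoids-rc-rc π≤ p-pat av) (patterns , avoid))

block : ∀ {v d} → Labelling v d → Fin d → List ℕ
block {v} D i = least D i ∷ (map (mid D i) (allFin (v ∸ 2)) ++ [ top D i ])

rcLabelling : ∀ {v d} → ℕ → Labelling v d → Labelling v d
rcLabelling n D = record
  { least = λ i → complement n (top D (opposite i))
  ; mid   = λ i j → complement n (mid D (opposite i) (opposite j))
  ; top   = λ i → complement n (least D (opposite i))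
  }

reverseComplement-block : ∀ {v d} n (D : Labelling v d) i →
  reverseComplement n (block D (opposite i)) ≡ block (rcLabelling n D) i
reverseComplement-block {v} n D i = begin
  map c (reverse (least D i′ ∷ (ms ∷ʳ top D i′)))
    ≡⟨ cong (map c) (reverse-∷-∷ʳ (least D i′) ms (top D i′)) ⟩
  c (top D i′) ∷ map c (reverse ms ∷ʳ least D i′)
    ≡⟨ cong (c (top D i′) ∷_) (map-++ c (reverse ms) [ least D i′ ]) ⟩
  c (top D i′) ∷ (map c (reverse ms) ∷ʳ c (least D i′))
    ≡⟨ cong (λ zs → c (top D i′) ∷ (map c zs ∷ʳ c (least D i′))) (reverse-map-allFin (mid D i′)) ⟩
  c (top D i′) ∷ (map c (map (mid D i′ ∘ opposite) (allFin (v ∸ 2))) ∷ʳ c (least D i′))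
    ≡⟨ cong (λ zs → c (top D i′) ∷ (zs ∷ʳ c (least D i′))) (sym (map-∘ (allFin (v ∸ 2)))) ⟩
  block (rcLabelling n D) i
    ∎
  where
  open ≡-Reasoning
  c = complement n
  i′ = opposite i
  ms = map (mid D i′) (allFin (v ∸ 2))

reverseComplement-πD : ∀ {v d} n (D : Labelling v d) → reverseComplement n (πD D) ≡ πD (rcLabelling n D)
reverseComplement-πD {d = d} n D = begin
  map c (reverse (concat (map blocks (allFin d))))                    ≡⟨ cong (map c) (reverse-concat (map blocks (allFin d))) ⟩
  map c (concat (reverse (map reverse (map blocks (allFin d)))))      ≡⟨ cong (map c ∘ concat ∘ reverse) (sym (map-∘ (allFin d))) ⟩
  map c (concat (reverse (map (reverse ∘ blocks) (allFin d))))        ≡⟨ cong (map c ∘ concat) (reverse-map-allFin (reverse ∘ blocks)) ⟩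
  map c (concat (map (reverse ∘ blocks ∘ opposite) (allFin d)))       ≡⟨ sym (concat-map (map (reverse ∘ blocks ∘ opposite) (allFin d))) ⟩
  concat (map (map c) (map (reverse ∘ blocks ∘ opposite) (allFin d))) ≡⟨ cong concat (sym (map-∘ (allFin d))) ⟩
  concat (map (reverseComplement n ∘ blocks ∘ opposite) (allFin d))   ≡⟨ cong concat (map-cong (reverseComplement-block n D) (allFin d)) ⟩
  πD (rcLabelling n D)                                                ∎
  where
  open ≡-Reasoning
  c = complement n
  blocks = block D

∈-block⇒∈-πD : ∀ {v d} (D : Labelling v d) i {x} → x ∈ block D i → x ∈ πD D
∈-block⇒∈-πD D i x∈ = ∈-concat⁺′ x∈ (∈-map⁺ (block D) (∈-allFin i))

rcLabelling-isDiamondLabelling : ∀ {v d} (D : Labelling v d) → IsDiamondLabelling D →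
  IsDiamondLabelling (rcLabelling (length (πD D)) D)
rcLabelling-isDiamondLabelling {v} D (π↭ , ordered) =
  subst (_↭ _) (reverseComplement-πD n D) (rc-perm π↭) ,
  λ i j → let i′ = opposite i ; j′ = opposite j ; least<mid , mid<top = ordered i′ j′ in
    complement-antitone mid<top (bounded (there (∈-++⁺ʳ (map (mid D i′) (allFin (v ∸ 2))) (here refl)))) ,
    complement-antitone least<mid (bounded (there (∈-++⁺ˡ (∈-map⁺ (mid D i′) (∈-allFin j′)))))
  where
  n = length (πD D)
  bounded : ∀ {i x} → x ∈ block D i → x ≤ suc n
  bounded x∈ = All.lookup (perm⇒bounded π↭) (∈-block⇒∈-πD D _ x∈)

rc-diamond : ∀ {v d} (D : Labelling v d) → IsDiamondLabelling D →
  Σ (Labelling v d) λ D′ → IsDiamondLabelling D′ × (rc (πD D) ≡ πD D′)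
rc-diamond D isD = rcLabelling _ D , rcLabelling-isDiamondLabelling D isD , reverseComplement-πD _ D

rc-avoiders : ∀ {v d} P → All IsPattern P → (π : List ℕ) →
  (Σ (Labelling v d) λ D → InDP P D × (rc (πD D) ≡ π))
  ⇔ (Σ (Labelling v d) λ D → InDP (map rc P) D × (πD D ≡ π))
rc-avoiders {v} {d} P patterns π = mk⇔ forward backward
  where
  bounded : (D : Labelling v d) → IsDiamondLabelling D → Bounded (πD D)
  bounded D = perm⇒bounded ∘ proj₁
  forward : (Σ (Labelling v d) λ D → InDP P D × (rc (πD D) ≡ π)) →
            (Σ (Labelling v d) λ D → InDP (map rc P) D × (πD D ≡ π))
  forward (D , (isD , avoid) , rcπD≡π) =
    rcLabelling _ D ,
    (rcLabelling-isDiamondLabelling D isD ,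
     subst (λ τ → All (Avoids τ) (map rc P)) (reverseComplement-πD _ D)
       (all-avoids-rc-rc (bounded D isD) patterns avoid)) ,
    trans (sym (reverseComplement-πD _ D)) rcπD≡π
  backward : (Σ (Labelling v d) λ D → InDP (map rc P) D × (πD D ≡ π)) →
             (Σ (Labelling v d) λ D → InDP P D × (rc (πD D) ≡ π))
  backward (D , (isD , avoid) , πD≡π) =
    rcLabelling _ D ,
    (rcLabelling-isDiamondLabelling D isD ,
     subst (λ τ → All (Avoids τ) P) (reverseComplement-πD _ D)
       (all-avoids-rc (bounded D isD) patterns avoid)) ,
    trans (cong rc (sym (reverseComplement-πD _ D))) (trans (rc-involutive (bounded D isD)) πD≡π)

proposition2p3 : (v d : ℕ) → v ≥ 4 → d ≥ 1 →
    ((D : Labelling v d) → IsDiamondLabelling D →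
       Σ (Labelling v d) λ D′ → IsDiamondLabelling D′ × (rc (πD D) ≡ πD D′))
    × ((p : List ℕ) → IsPattern p → (π : List ℕ) →
       (Σ (Labelling v d) λ D → InDP (p ∷ []) D × (rc (πD D) ≡ π))
       ⇔ (Σ (Labelling v d) λ D → InDP (rc p ∷ []) D × (πD D ≡ π)))
    × ((P : List (List ℕ)) → length P ≥ 1 → All IsPattern P → (π : List ℕ) →
       (Σ (Labelling v d) λ D → InDP P D × (rc (πD D) ≡ π))
       ⇔ (Σ (Labelling v d) λ D → InDP (map rc P) D × (πD D ≡ π)))
proposition2p3 v d _ _ =
  rc-diamond ,
  (λ p p-pat → rc-avoiders (p ∷ []) (p-pat ∷ [])) ,
  (λ P _ → rc-avoiders P)
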